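{- If $G$ is a cyclic group of order $|G|\ge 3$, then $s_{\min}(G)=2$ if $|G|$ is even and $s_{\min}(G)=3$ if $|G|$ is odd.
   Context: For a finite abelian group $G$ with $n=|G|$, let $\mathcal C(G)$ be the set of Hamiltonian cycles in the complete digraph on vertex set $G$; a cycle is written $C=(g_1,\ldots,g_n)$, a listing of all elements of $G$, indices modulo $n$. Let $S(C)=\{g_i+g_{i+1} : 1\le i\le n\}$ (indices mod $n$) and $s_{\min}(G)=\min\{|S(C)| : C\in\mathcal C(G)\}$. -}

module Defs where

open import Data.Nat using (ℕ; zero; suc; _+_; _≤_; _%_)
open import Data.Nat.DivMod using (m%n<n)
open import Data.Fin using (Fin; toℕ; fromℕ<)
open import Data.Fin.Subset using (Subset; ⁅_⁆; ⋃; ∣_∣)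
open import Data.Fin.Permutation using (Permutation′; _⟨$⟩ʳ_)
open import Data.List using (map; allFin)
open import Data.Product using (Σ; _×_)
open import Relation.Binary.PropositionalEquality using (_≡_)

_+ₙ_ : ∀ {n} → Fin n → Fin n → Fin n
_+ₙ_ {suc m} a b = fromℕ< (m%n<n (toℕ a + toℕ b) (suc m))

nextIdx : ∀ {n} → Fin n → Fin n
nextIdx {suc m} i = fromℕ< (m%n<n (suc (toℕ i)) (suc m))

-- A Hamiltonian cycle C = (g_0, …, g_{n-1}) in the complete digraph on ℤ/nℤ:
-- a listing of all elements, i.e. a bijection from positions to elements.
HamCycle : ℕ → Set
HamCycle n = Permutation′ n

S : ∀ {n} → HamCycle n → Subset n
S {n} C = ⋃ (map (λ i → ⁅ (C ⟨$⟩ʳ i) +ₙ (C ⟨$⟩ʳ nextIdx i) ⁆) (allFin n))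

IsSMin : ℕ → ℕ → Set
IsSMin n k = Σ (HamCycle n) (λ C → ∣ S C ∣ ≡ k) × ((C : HamCycle n) → k ≤ ∣ S C ∣)

{-# OPTIONS --safe #-}
module Submission where

-- Two consecutive sums of a Hamiltonian cycle differ: g_{i-1} + g_i = g_i + g_{i+1}
-- would force g_{i-1} = g_{i+1}, impossible once n ≥ 3. Hence |S(C)| ≥ 2, and when
-- n is odd two values cannot alternate around the cycle, so |S(C)| ≥ 3. For the
-- matching cycles fix an even c ∈ {n - 1, n} and list g_j = j for even j and
-- g_j = c - j for odd j. This is an involution of {0, …, n - 1} whose inner sums are
-- c - 1 and c + 1; the closing sum g_{n-1} + g_0 is 1 ≡ c + 1 when c = n and is
-- n - 1 when c = n - 1.

open import Defs
open import Data.Nat using (ℕ; zero; suc; _+_; _*_; _∸_; _≤_; _<_; z≤n; s≤s; _%_; _≤?_; NonZero; parity)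
open import Data.Nat.Properties
  using ( +-assoc; +-comm; +-suc; +-identityʳ; *-suc; 0≢1+n; n≤1+n; n<1+n; m<n⇒m<1+n; <⇒≤; ≤-pred
        ; ≤-refl; ≤-trans; ≤-reflexive; ≤-antisym; +-mono-≤; +-monoʳ-≤; ∸-monoʳ-≤; ∸-monoˡ-≤
        ; m≤n⇒m<n∨m≡n; m+[n∸m]≡n; m∸n+n≡m; m∸[m∸n]≡n; m+n∸n≡m; module ≤-Reasoning )
open import Data.Nat.DivMod using (_mod_; %-distribˡ-+; m%n%n≡m%n; [m+kn]%n≡m%n; [m+n]%n≡m%n; m<n⇒m%n≡m; n%n≡0)
open import Data.Nat.Divisibility using (_∣_; divides; ∣-refl; ∣m∣n⇒∣m+n)
open import Data.Parity.Base using (0ℙ; 1ℙ; _⁻¹) renaming (_+_ to _+ℙ_)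
import Data.Parity.Properties as ℙ
open import Data.Fin using (Fin; toℕ; fromℕ<; _≟_)
open import Data.Fin.Properties using (toℕ-injective; toℕ-fromℕ<; toℕ<n)
open import Data.Fin.Subset using (Subset; ⁅_⁆; ⋃; ∣_∣; _∪_; _∈_; _⊆_; _-_; outside; inside)
open import Data.Fin.Subset.Properties
  using (x∈p⇒∣p-x∣<∣p∣; x∈p∧x≢y⇒x∈p-y; ∉⊥; x∈p∪q⁻; x∈p∪q⁺; x∈⁅x⁆; x∈⁅y⁆⇒x≡y; ∣⁅x⁆∣≡1; p⊆q⇒∣p∣≤∣q∣; ∪-idem)
open import Data.Fin.Permutation using (permutation; _⟨$⟩ʳ_; _⟨$⟩ˡ_; inverseˡ)
open import Data.List using (List; []; _∷_; map; allFin)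
open import Data.List.Relation.Unary.Any using (here; there)
import Data.List.Membership.Propositional as List
open import Data.List.Membership.Propositional.Properties using (∈-allFin)
open import Data.Vec using ([]; _∷_)
open import Data.Product using (_×_; _,_)
open import Data.Sum using (_⊎_; inj₁; inj₂; [_,_])
open import Data.Empty using (⊥-elim)
open import Relation.Nullary using (¬_; yes; no; contradiction)
open import Relation.Binary.PropositionalEquality
  using (_≡_; _≢_; refl; sym; trans; cong; cong₂; subst; module ≡-Reasoning)

private
  variable
    m n : ℕ

parity-cases : ∀ n → parity n ≡ 0ℙ ⊎ parity n ≡ 1ℙ
parity-cases n with parity n
... | 0ℙ = inj₁ refl
... | 1ℙ = inj₂ refl

2∣⇒parity≡0ℙ : 2 ∣ n → parity n ≡ 0ℙ
2∣⇒parity≡0ℙ (divides q refl) = trans (ℙ.*-homo-* q 2) (ℙ.*-zeroʳ (parity q))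

parity≡0ℙ⇒2∣ : ∀ n → parity n ≡ 0ℙ → 2 ∣ n
parity≡0ℙ⇒2∣ zero          _ = divides 0 refl
parity≡0ℙ⇒2∣ (suc (suc n)) p = ∣m∣n⇒∣m+n ∣-refl (parity≡0ℙ⇒2∣ n p)

¬2∣⇒parity≡1ℙ : ¬ 2 ∣ n → parity n ≡ 1ℙ
¬2∣⇒parity≡1ℙ {n} ¬2∣n with parity-cases n
... | inj₁ n-even = contradiction (parity≡0ℙ⇒2∣ n n-even) ¬2∣n
... | inj₂ n-odd  = n-odd

parity-suc : ∀ n → parity (suc n) ≡ parity n ⁻¹
parity-suc n = sym (ℙ.⁻¹-selfInverse (ℙ.suc-homo-⁻¹ n))

parity[m∸n] : ∀ {m n} → n ≤ m → parity (m ∸ n) ≡ parity m +ℙ parity n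
parity[m∸n] {m} {n} n≤m = begin
  parity (m ∸ n)                                 ≡⟨ ℙ.+-identityʳ _ ⟨
  parity (m ∸ n) +ℙ 0ℙ                          ≡⟨ cong (parity (m ∸ n) +ℙ_) (ℙ.p+p≡0ℙ (parity n)) ⟨
  parity (m ∸ n) +ℙ (parity n +ℙ parity n)     ≡⟨ ℙ.+-assoc (parity (m ∸ n)) (parity n) (parity n) ⟨
  (parity (m ∸ n) +ℙ parity n) +ℙ parity n     ≡⟨ cong (_+ℙ parity n) (ℙ.+-homo-+ (m ∸ n) n) ⟨
  parity (m ∸ n + n) +ℙ parity n                ≡⟨ cong (λ k → parity k +ℙ parity n) (m∸n+n≡m n≤m) ⟩
  parity m +ℙ parity n                          ∎
  where open ≡-Reasoning

%-congʳ-+ : ∀ {n} .{{_ : NonZero n}} z x y → x % n ≡ y % n → (z + x) % n ≡ (z + y) % n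
%-congʳ-+ {n} z x y x≡y = begin
  (z + x) % n          ≡⟨ %-distribˡ-+ z x n ⟩
  (z % n + x % n) % n  ≡⟨ cong (λ r → (z % n + r) % n) x≡y ⟩
  (z % n + y % n) % n  ≡⟨ %-distribˡ-+ z y n ⟨
  (z + y) % n          ∎
  where open ≡-Reasoning

-- Adding z * (n - 1) turns x + z into x + z * n.
%-cancelʳ-+ : ∀ x y z → (x + z) % suc m ≡ (y + z) % suc m → x % suc m ≡ y % suc m
%-cancelʳ-+ {m} x y z x+z≡y+z = begin
  x % suc m                      ≡⟨ [m+kn]%n≡m%n x z (suc m) ⟨
  (x + z * suc m) % suc m        ≡⟨ cong (_% suc m) (shift x) ⟩
  (z * m + (x + z)) % suc m      ≡⟨ %-congʳ-+ (z * m) (x + z) (y + z) x+z≡y+z ⟩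
  (z * m + (y + z)) % suc m      ≡⟨ cong (_% suc m) (shift y) ⟨
  (y + z * suc m) % suc m        ≡⟨ [m+kn]%n≡m%n y z (suc m) ⟩
  y % suc m                      ∎
  where
  open ≡-Reasoning
  shift : ∀ w → w + z * suc m ≡ z * m + (w + z)
  shift w = trans (cong (w +_) (*-suc z m)) (trans (sym (+-assoc w z (z * m))) (+-comm (w + z) (z * m)))

toℕ-mod : ∀ k → toℕ (k mod suc m) ≡ k % suc m
toℕ-mod k = toℕ-fromℕ< _

%≡⇒mod≡ : ∀ x y → x % suc m ≡ y % suc m → x mod suc m ≡ y mod suc m
%≡⇒mod≡ x y x≡y = toℕ-injective (trans (toℕ-mod x) (trans x≡y (sym (toℕ-mod y))))

mod≡⇒%≡ : ∀ x y → x mod suc m ≡ y mod suc m → x % suc m ≡ y % suc m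
mod≡⇒%≡ x y x≡y = trans (sym (toℕ-mod x)) (trans (cong toℕ x≡y) (toℕ-mod y))

toℕ-mod-id : ∀ (i : Fin (suc m)) → toℕ i mod suc m ≡ i
toℕ-mod-id i = toℕ-injective (trans (toℕ-mod (toℕ i)) (m<n⇒m%n≡m (toℕ<n i)))

+ₙ-comm : ∀ (a b : Fin (suc m)) → a +ₙ b ≡ b +ₙ a
+ₙ-comm a b = cong (_mod _) (+-comm (toℕ a) (toℕ b))

+ₙ-cancelʳ : ∀ {a b : Fin (suc m)} c → a +ₙ c ≡ b +ₙ c → a ≡ b
+ₙ-cancelʳ {m} {a} {b} c a+c≡b+c = begin
  a                  ≡⟨ toℕ-mod-id a ⟨
  toℕ a mod suc m    ≡⟨ %≡⇒mod≡ (toℕ a) (toℕ b) (%-cancelʳ-+ (toℕ a) (toℕ b) (toℕ c) a+c≡b+c[mod]) ⟩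
  toℕ b mod suc m    ≡⟨ toℕ-mod-id b ⟩
  b                  ∎
  where
  open ≡-Reasoning
  a+c≡b+c[mod] : (toℕ a + toℕ c) % suc m ≡ (toℕ b + toℕ c) % suc m
  a+c≡b+c[mod] = mod≡⇒%≡ (toℕ a + toℕ c) (toℕ b + toℕ c) a+c≡b+c

nextIdx-mod : ∀ k → nextIdx (k mod suc m) ≡ suc k mod suc m
nextIdx-mod {m} k = %≡⇒mod≡ (suc (toℕ (k mod suc m))) (suc k) (%-congʳ-+ 1 (toℕ (k mod suc m)) k toℕ[k-mod]≡k[mod])
  where
  toℕ[k-mod]≡k[mod] : toℕ (k mod suc m) % suc m ≡ k % suc m
  toℕ[k-mod]≡k[mod] = trans (cong (_% suc m) (toℕ-mod k)) (m%n%n≡m%n k (suc m))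

[2+k]mod≢[k]mod : 2 ≤ m → ∀ k → (2 + k) mod suc m ≢ k mod suc m
[2+k]mod≢[k]mod {m} 2≤m k 2+k≡k =
  0≢1+n (trans (sym (%-cancelʳ-+ 2 0 k (mod≡⇒%≡ (2 + k) k 2+k≡k))) (m<n⇒m%n≡m (s≤s 2≤m)))

k≤∣p-x∣⇒1+k≤∣p∣ : ∀ {p : Subset n} {x k} → x ∈ p → k ≤ ∣ p - x ∣ → suc k ≤ ∣ p ∣
k≤∣p-x∣⇒1+k≤∣p∣ x∈p k≤∣p-x∣ = ≤-trans (s≤s k≤∣p-x∣) (x∈p⇒∣p-x∣<∣p∣ x∈p)

two-members⇒2≤∣p∣ : ∀ {p : Subset n} {x y} → x ∈ p → y ∈ p → x ≢ y → 2 ≤ ∣ p ∣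
two-members⇒2≤∣p∣ x∈p y∈p x≢y =
  k≤∣p-x∣⇒1+k≤∣p∣ x∈p (k≤∣p-x∣⇒1+k≤∣p∣ (x∈p∧x≢y⇒x∈p-y y∈p (λ e → x≢y (sym e))) z≤n)

three-members⇒3≤∣p∣ : ∀ {p : Subset n} {x y z} → x ∈ p → y ∈ p → z ∈ p →
                      x ≢ y → x ≢ z → y ≢ z → 3 ≤ ∣ p ∣
three-members⇒3≤∣p∣ x∈p y∈p z∈p x≢y x≢z y≢z =
  k≤∣p-x∣⇒1+k≤∣p∣ x∈p
    (two-members⇒2≤∣p∣ (x∈p∧x≢y⇒x∈p-y y∈p (λ e → x≢y (sym e)))
                       (x∈p∧x≢y⇒x∈p-y z∈p (λ e → x≢z (sym e))) y≢z)

∣p∪q∣≤∣p∣+∣q∣ : ∀ (p q : Subset n) → ∣ p ∪ q ∣ ≤ ∣ p ∣ + ∣ q ∣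
∣p∪q∣≤∣p∣+∣q∣ []            []            = z≤n
∣p∪q∣≤∣p∣+∣q∣ (outside ∷ p) (outside ∷ q) = ∣p∪q∣≤∣p∣+∣q∣ p q
∣p∪q∣≤∣p∣+∣q∣ (outside ∷ p) (inside ∷ q)  = ≤-trans (s≤s (∣p∪q∣≤∣p∣+∣q∣ p q)) (≤-reflexive (sym (+-suc ∣ p ∣ ∣ q ∣)))
∣p∪q∣≤∣p∣+∣q∣ (inside ∷ p)  (outside ∷ q) = s≤s (∣p∪q∣≤∣p∣+∣q∣ p q)
∣p∪q∣≤∣p∣+∣q∣ (inside ∷ p)  (inside ∷ q)  = s≤s (≤-trans (∣p∪q∣≤∣p∣+∣q∣ p q) (+-monoʳ-≤ ∣ p ∣ (n≤1+n ∣ q ∣)))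

x≡y⇒x∈⁅y⁆ : ∀ {x y : Fin n} → x ≡ y → x ∈ ⁅ y ⁆
x≡y⇒x∈⁅y⁆ refl = x∈⁅x⁆ _

∣⁅x⁆∪⁅y⁆∣≤2 : ∀ (x y : Fin n) → ∣ ⁅ x ⁆ ∪ ⁅ y ⁆ ∣ ≤ 2
∣⁅x⁆∪⁅y⁆∣≤2 x y = ≤-trans (∣p∪q∣≤∣p∣+∣q∣ ⁅ x ⁆ ⁅ y ⁆) (≤-reflexive (cong₂ _+_ (∣⁅x⁆∣≡1 x) (∣⁅x⁆∣≡1 y)))

∣⁅x⁆∪⁅y⁆∪⁅z⁆∣≤3 : ∀ (x y z : Fin n) → ∣ ⁅ x ⁆ ∪ ⁅ y ⁆ ∪ ⁅ z ⁆ ∣ ≤ 3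
∣⁅x⁆∪⁅y⁆∪⁅z⁆∣≤3 x y z =
  ≤-trans (∣p∪q∣≤∣p∣+∣q∣ ⁅ x ⁆ (⁅ y ⁆ ∪ ⁅ z ⁆)) (+-mono-≤ (≤-reflexive (∣⁅x⁆∣≡1 x)) (∣⁅x⁆∪⁅y⁆∣≤2 y z))

image : ∀ {k} → (Fin k → Fin n) → List (Fin k) → Subset n
image f is = ⋃ (map (λ i → ⁅ f i ⁆) is)

∈-image : ∀ {k} (f : Fin k → Fin n) {i is} → i List.∈ is → f i ∈ image f is
∈-image f (here refl) = x∈p∪q⁺ (inj₁ (x∈⁅x⁆ (f _)))
∈-image f (there i∈is) = x∈p∪q⁺ (inj₂ (∈-image f i∈is))

image⊆ : ∀ {k} (f : Fin k → Fin n) {q : Subset n} → (∀ i → f i ∈ q) → ∀ is → image f is ⊆ q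
image⊆ f f∈q []       x∈ = ⊥-elim (∉⊥ x∈)
image⊆ f f∈q (i ∷ is) x∈ =
  [ (λ x∈⁅fi⁆ → subst (_∈ _) (sym (x∈⁅y⁆⇒x≡y (f i) x∈⁅fi⁆)) (f∈q i)) , image⊆ f f∈q is ]
    (x∈p∪q⁻ ⁅ f i ⁆ (image f is) x∈)

module _ {a} {A : Set a} {x y : A} where

  private
    _∈₂ : A → Set a
    u ∈₂ = u ≡ x ⊎ u ≡ y

  both-≢⇒≡ : ∀ {u v w} → u ∈₂ → v ∈₂ → w ∈₂ → u ≢ v → w ≢ v → u ≡ w
  both-≢⇒≡ (inj₁ refl) _           (inj₁ refl) _   _   = refl
  both-≢⇒≡ (inj₂ refl) _           (inj₂ refl) _   _   = refl
  both-≢⇒≡ (inj₁ refl) (inj₁ refl) (inj₂ refl) u≢v _   = contradiction refl u≢v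
  both-≢⇒≡ (inj₁ refl) (inj₂ refl) (inj₂ refl) _   w≢v = contradiction refl w≢v
  both-≢⇒≡ (inj₂ refl) (inj₁ refl) (inj₁ refl) _   w≢v = contradiction refl w≢v
  both-≢⇒≡ (inj₂ refl) (inj₂ refl) (inj₁ refl) u≢v _   = contradiction refl u≢v

  module _ {t : ℕ → A} (t-suc≢ : ∀ k → t (suc k) ≢ t k) (t∈₂ : ∀ k → t k ∈₂) where

    alternating-2-periodic : ∀ k → t (2 + k) ≡ t k
    alternating-2-periodic k =
      both-≢⇒≡ (t∈₂ (2 + k)) (t∈₂ (suc k)) (t∈₂ k) (t-suc≢ (suc k)) (λ e → t-suc≢ k (sym e))

    alternating-odd : ∀ n → parity n ≡ 1ℙ → t n ≡ t 1
    alternating-odd (suc zero)    _     = refl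
    alternating-odd (suc (suc n)) n-odd = trans (alternating-2-periodic n) (alternating-odd n n-odd)

    alternating-odd≢ : ∀ n → parity n ≡ 1ℙ → t n ≢ t 0
    alternating-odd≢ n n-odd tn≡t0 = t-suc≢ 0 (trans (sym (alternating-odd n n-odd)) tn≡t0)

-- Edge sums of a Hamiltonian cycle, with positions read modulo n

⟨$⟩ʳ-injective : ∀ (C : HamCycle n) {i j} → C ⟨$⟩ʳ i ≡ C ⟨$⟩ʳ j → i ≡ j
⟨$⟩ʳ-injective C Ci≡Cj = trans (sym (inverseˡ C)) (trans (cong (C ⟨$⟩ˡ_) Ci≡Cj) (inverseˡ C))

module _ {m : ℕ} (C : HamCycle (suc m)) where

  vertex : ℕ → Fin (suc m)
  vertex k = C ⟨$⟩ʳ (k mod suc m)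

  edgeSum : ℕ → Fin (suc m)
  edgeSum k = vertex k +ₙ vertex (suc k)

  private
    sumAt : Fin (suc m) → Fin (suc m)
    sumAt i = (C ⟨$⟩ʳ i) +ₙ (C ⟨$⟩ʳ nextIdx i)

    sumAt-mod : ∀ k → sumAt (k mod suc m) ≡ edgeSum k
    sumAt-mod k = cong (λ j → vertex k +ₙ (C ⟨$⟩ʳ j)) (nextIdx-mod k)

  edgeSum∈S : ∀ k → edgeSum k ∈ S C
  edgeSum∈S k = subst (_∈ S C) (sumAt-mod k) (∈-image sumAt (∈-allFin (k mod suc m)))

  S⊆ : ∀ {q : Subset (suc m)} → (∀ k → k < suc m → edgeSum k ∈ q) → S C ⊆ q
  S⊆ {q} edgeSum∈q = image⊆ sumAt sumAt∈q (allFin (suc m))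
    where
    sumAt∈q : ∀ i → sumAt i ∈ q
    sumAt∈q i = subst (_∈ q) (trans (sym (sumAt-mod (toℕ i))) (cong sumAt (toℕ-mod-id i)))
                      (edgeSum∈q (toℕ i) (toℕ<n i))

  edgeSum-periodic : ∀ k → edgeSum (k + suc m) ≡ edgeSum k
  edgeSum-periodic k = cong₂ _+ₙ_ (vertex-periodic k) (vertex-periodic (suc k))
    where
    vertex-periodic : ∀ j → vertex (j + suc m) ≡ vertex j
    vertex-periodic j = cong (C ⟨$⟩ʳ_) (%≡⇒mod≡ (j + suc m) j ([m+n]%n≡m%n j (suc m)))

  edgeSum-suc≢ : 2 ≤ m → ∀ k → edgeSum (suc k) ≢ edgeSum k
  edgeSum-suc≢ 2≤m k sk≡k = [2+k]mod≢[k]mod 2≤m k (⟨$⟩ʳ-injective C (+ₙ-cancelʳ (vertex (suc k))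
    (trans (+ₙ-comm (vertex (2 + k)) (vertex (suc k))) sk≡k)))

  2≤∣S∣ : 2 ≤ m → 2 ≤ ∣ S C ∣
  2≤∣S∣ 2≤m = two-members⇒2≤∣p∣ (edgeSum∈S 1) (edgeSum∈S 0) (edgeSum-suc≢ 2≤m 0)

  odd⇒3≤∣S∣ : 2 ≤ m → parity (suc m) ≡ 1ℙ → 3 ≤ ∣ S C ∣
  odd⇒3≤∣S∣ 2≤m n-odd with 3 ≤? ∣ S C ∣
  ... | yes 3≤∣S∣ = 3≤∣S∣
  ... | no 3≰∣S∣ =
    contradiction (edgeSum-periodic 0) (alternating-odd≢ (edgeSum-suc≢ 2≤m) twoValued (suc m) n-odd)
    where
    twoValued : ∀ k → edgeSum k ≡ edgeSum 0 ⊎ edgeSum k ≡ edgeSum 1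
    twoValued k with edgeSum k ≟ edgeSum 0 | edgeSum k ≟ edgeSum 1
    ... | yes k≡0 | _       = inj₁ k≡0
    ... | no _    | yes k≡1 = inj₂ k≡1
    ... | no k≢0  | no k≢1  = contradiction
      (three-members⇒3≤∣p∣ (edgeSum∈S k) (edgeSum∈S 0) (edgeSum∈S 1) k≢0 k≢1
                           (λ 0≡1 → edgeSum-suc≢ 2≤m 0 (sym 0≡1)))
      3≰∣S∣

-- The zigzag cycle

zigzag : ℕ → ℕ → ℕ
zigzag c j with parity j
... | 0ℙ = j
... | 1ℙ = c ∸ j

zigzag-even : ∀ c j → parity j ≡ 0ℙ → zigzag c j ≡ j
zigzag-even c j j-even rewrite j-even = refl

zigzag-odd : ∀ c j → parity j ≡ 1ℙ → zigzag c j ≡ c ∸ j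
zigzag-odd c j j-odd rewrite j-odd = refl

zigzag-involutive : ∀ {c j} → parity c ≡ 0ℙ → j ≤ c → zigzag c (zigzag c j) ≡ j
zigzag-involutive {c} {j} c-even j≤c with parity-cases j
... | inj₁ j-even = trans (cong (zigzag c) (zigzag-even c j j-even)) (zigzag-even c j j-even)
... | inj₂ j-odd = begin
  zigzag c (zigzag c j)  ≡⟨ cong (zigzag c) (zigzag-odd c j j-odd) ⟩
  zigzag c (c ∸ j)       ≡⟨ zigzag-odd c (c ∸ j) c∸j-odd ⟩
  c ∸ (c ∸ j)            ≡⟨ m∸[m∸n]≡n j≤c ⟩
  j                      ∎
  where
  open ≡-Reasoning
  c∸j-odd : parity (c ∸ j) ≡ 1ℙ
  c∸j-odd = trans (parity[m∸n] j≤c) (cong₂ _+ℙ_ c-even j-odd)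

zigzag<1+m : ∀ {c j} → c ≤ suc m → j < suc m → zigzag c j < suc m
zigzag<1+m {c = c} {zero}  c≤1+m j<1+m = j<1+m
zigzag<1+m {c = c} {suc j} c≤1+m j<1+m with parity-cases (suc j)
... | inj₁ 1+j-even = subst (_< _) (sym (zigzag-even c (suc j) 1+j-even)) j<1+m
... | inj₂ 1+j-odd  = subst (_< _) (sym (zigzag-odd c (suc j) 1+j-odd))
                            (s≤s (≤-trans (∸-monoʳ-≤ c (s≤s (z≤n {j}))) (∸-monoˡ-≤ 1 c≤1+m)))

zigzag-sum : ∀ {c j} → parity c ≡ 0ℙ → suc j ≤ c →
             zigzag c j + zigzag c (suc j) ≡ c ∸ 1 ⊎ zigzag c j + zigzag c (suc j) ≡ suc c
zigzag-sum {c} {j} c-even 1+j≤c with parity-cases j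
... | inj₁ j-even = inj₁ (begin
  zigzag c j + zigzag c (suc j)  ≡⟨ cong₂ _+_ (zigzag-even c j j-even) (zigzag-odd c (suc j) 1+j-odd) ⟩
  j + (c ∸ suc j)                ≡⟨ cong (_∸ 1) (m+[n∸m]≡n 1+j≤c) ⟩
  c ∸ 1                          ∎)
  where
  open ≡-Reasoning
  1+j-odd : parity (suc j) ≡ 1ℙ
  1+j-odd = trans (parity-suc j) (cong _⁻¹ j-even)
... | inj₂ j-odd = inj₂ (begin
  zigzag c j + zigzag c (suc j)  ≡⟨ cong₂ _+_ (zigzag-odd c j j-odd) (zigzag-even c (suc j) 1+j-even) ⟩
  c ∸ j + suc j                  ≡⟨ +-suc (c ∸ j) j ⟩
  suc (c ∸ j + j)                ≡⟨ cong suc (m∸n+n≡m (<⇒≤ 1+j≤c)) ⟩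
  suc c                          ∎)
  where
  open ≡-Reasoning
  1+j-even : parity (suc j) ≡ 0ℙ
  1+j-even = trans (parity-suc j) (cong _⁻¹ j-odd)

module Zigzag (m c : ℕ) (c-even : parity c ≡ 0ℙ) (m≤c : m ≤ c) (c≤1+m : c ≤ suc m) where

  zigzagFin : Fin (suc m) → Fin (suc m)
  zigzagFin i = fromℕ< (zigzag<1+m c≤1+m (toℕ<n i))

  toℕ-zigzagFin : ∀ i → toℕ (zigzagFin i) ≡ zigzag c (toℕ i)
  toℕ-zigzagFin i = toℕ-fromℕ< _

  zigzagFin-involutive : ∀ i → zigzagFin (zigzagFin i) ≡ i
  zigzagFin-involutive i = toℕ-injective (begin
    toℕ (zigzagFin (zigzagFin i))  ≡⟨ toℕ-zigzagFin (zigzagFin i) ⟩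
    zigzag c (toℕ (zigzagFin i))   ≡⟨ cong (zigzag c) (toℕ-zigzagFin i) ⟩
    zigzag c (zigzag c (toℕ i))    ≡⟨ zigzag-involutive c-even (≤-trans (≤-pred (toℕ<n i)) m≤c) ⟩
    toℕ i                          ∎)
    where open ≡-Reasoning

  zigzagCycle : HamCycle (suc m)
  zigzagCycle = permutation zigzagFin zigzagFin zigzagFin-involutive zigzagFin-involutive

  toℕ-vertex : ∀ {k} → k < suc m → toℕ (vertex zigzagCycle k) ≡ zigzag c k
  toℕ-vertex {k} k<1+m =
    trans (toℕ-zigzagFin (k mod suc m)) (cong (zigzag c) (trans (toℕ-mod k) (m<n⇒m%n≡m k<1+m)))

  edgeSum-inner : ∀ {k} → k < m → edgeSum zigzagCycle k ≡ (zigzag c k + zigzag c (suc k)) mod suc m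
  edgeSum-inner k<m = cong₂ (λ a b → (a + b) mod suc m) (toℕ-vertex (m<n⇒m<1+n k<m)) (toℕ-vertex (s≤s k<m))

  edgeSum-closing : edgeSum zigzagCycle m ≡ zigzag c m mod suc m
  edgeSum-closing = trans (cong₂ (λ a b → (a + b) mod suc m) (toℕ-vertex (n<1+n m)) toℕ-vertex-1+m)
                          (cong (_mod suc m) (+-identityʳ (zigzag c m)))
    where
    toℕ-vertex-1+m : toℕ (vertex zigzagCycle (suc m)) ≡ 0
    toℕ-vertex-1+m = trans (toℕ-zigzagFin (suc m mod suc m))
                           (cong (zigzag c) (trans (toℕ-mod {m} (suc m)) (n%n≡0 (suc m))))

  lowSum highSum closingSum : Fin (suc m)
  lowSum     = (c ∸ 1) mod suc m
  highSum    = suc c mod suc m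
  closingSum = zigzag c m mod suc m

  S-zigzagCycle⊆ : S zigzagCycle ⊆ ⁅ lowSum ⁆ ∪ ⁅ highSum ⁆ ∪ ⁅ closingSum ⁆
  S-zigzagCycle⊆ = S⊆ zigzagCycle edgeSum∈
    where
    edgeSum∈ : ∀ k → k < suc m → edgeSum zigzagCycle k ∈ ⁅ lowSum ⁆ ∪ ⁅ highSum ⁆ ∪ ⁅ closingSum ⁆
    edgeSum∈ k k<1+m with m≤n⇒m<n∨m≡n (≤-pred k<1+m)
    ... | inj₂ refl = x∈p∪q⁺ (inj₂ (x∈p∪q⁺ (inj₂ (x≡y⇒x∈⁅y⁆ edgeSum-closing))))
    ... | inj₁ k<m with zigzag-sum c-even (≤-trans k<m m≤c)
    ...   | inj₁ ≡c∸1 = x∈p∪q⁺ (inj₁ (x≡y⇒x∈⁅y⁆ (trans (edgeSum-inner k<m) (cong (_mod suc m) ≡c∸1))))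
    ...   | inj₂ ≡1+c = x∈p∪q⁺ (inj₂ (x∈p∪q⁺ (inj₁ (x≡y⇒x∈⁅y⁆ (trans (edgeSum-inner k<m) (cong (_mod suc m) ≡1+c))))))

  ∣S-zigzagCycle∣≤3 : ∣ S zigzagCycle ∣ ≤ 3
  ∣S-zigzagCycle∣≤3 = ≤-trans (p⊆q⇒∣p∣≤∣q∣ S-zigzagCycle⊆) (∣⁅x⁆∪⁅y⁆∪⁅z⁆∣≤3 lowSum highSum closingSum)

  ∣S-zigzagCycle∣≤2 : closingSum ≡ highSum → ∣ S zigzagCycle ∣ ≤ 2
  ∣S-zigzagCycle∣≤2 closing≡high = begin
    ∣ S zigzagCycle ∣                             ≤⟨ p⊆q⇒∣p∣≤∣q∣ S-zigzagCycle⊆ ⟩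
    ∣ ⁅ lowSum ⁆ ∪ ⁅ highSum ⁆ ∪ ⁅ closingSum ⁆ ∣  ≡⟨ cong (λ x → ∣ ⁅ lowSum ⁆ ∪ ⁅ highSum ⁆ ∪ ⁅ x ⁆ ∣) closing≡high ⟩
    ∣ ⁅ lowSum ⁆ ∪ ⁅ highSum ⁆ ∪ ⁅ highSum ⁆ ∣     ≡⟨ cong (λ p → ∣ ⁅ lowSum ⁆ ∪ p ∣) (∪-idem ⁅ highSum ⁆) ⟩
    ∣ ⁅ lowSum ⁆ ∪ ⁅ highSum ⁆ ∣                  ≤⟨ ∣⁅x⁆∪⁅y⁆∣≤2 lowSum highSum ⟩
    2                                            ∎
    where open ≤-Reasoning

isSMin-even : 2 ≤ m → parity (suc m) ≡ 0ℙ → IsSMin (suc m) 2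
isSMin-even {m} 2≤m n-even =
  (zigzagCycle , ≤-antisym (∣S-zigzagCycle∣≤2 closing≡high) (2≤∣S∣ zigzagCycle 2≤m)) , λ C → 2≤∣S∣ C 2≤m
  where
  open Zigzag m (suc m) n-even (n≤1+n m) ≤-refl
  m-odd : parity m ≡ 1ℙ
  m-odd = trans (sym (ℙ.suc-homo-⁻¹ m)) (cong _⁻¹ n-even)
  closing≡high : closingSum ≡ highSum
  closing≡high = trans (cong (_mod suc m) (trans (zigzag-odd (suc m) m m-odd) (m+n∸n≡m 1 m)))
                       (%≡⇒mod≡ 1 (2 + m) (sym ([m+n]%n≡m%n 1 (suc m))))

isSMin-odd : 2 ≤ m → parity (suc m) ≡ 1ℙ → IsSMin (suc m) 3
isSMin-odd {m} 2≤m n-odd =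
  (zigzagCycle , ≤-antisym ∣S-zigzagCycle∣≤3 (odd⇒3≤∣S∣ zigzagCycle 2≤m n-odd)) , λ C → odd⇒3≤∣S∣ C 2≤m n-odd
  where
  m-even : parity m ≡ 0ℙ
  m-even = trans (sym (ℙ.suc-homo-⁻¹ m)) (cong _⁻¹ n-odd)
  open Zigzag m m m-even ≤-refl (n≤1+n m)

theorem5 : (n : ℕ) → 3 ≤ n → ((2 ∣ n) → IsSMin n 2) × (¬ (2 ∣ n) → IsSMin n 3)
theorem5 (suc m) (s≤s 2≤m) =
  (λ 2∣n → isSMin-even 2≤m (2∣⇒parity≡0ℙ 2∣n)) , (λ ¬2∣n → isSMin-odd 2≤m (¬2∣⇒parity≡1ℙ ¬2∣n))
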